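{- Let $G=(V,E)$ be a connected graph with $V=[m]$ whose edges are subsets $e\subseteq V$ with $|e|\in\{1,2\}$ (self-loops allowed), with incidence matrix $\mathbf A_{ve}=2I(v\in e)/|e|$. Fix a spanning tree with edge set $E_s\subseteq E$ and root $v_{root}$, let $F=E\setminus E_s$, and define for each $\{v,v'\}\in F$ the vector $$\mathbf c(v,v')=\mathbf n(\{v,v'\})+\sum_{e\in E(v)}(-1)^{\mathrm{depth}(v)+\mathrm{depth}(e)}\mathbf n(e)+\sum_{e'\in E(v')}(-1)^{\mathrm{depth}(v')+\mathrm{depth}(e')}\mathbf n(e').$$ Let $F_c=\{\{v,v'\}\in F:\mathrm{depth}(v)+\mathrm{depth}(v')\text{ is odd}\}$. Then the vectors $\mathbf c(e)$, $e\in F_c$, lie in $\mathrm{Null}(\mathbf A)$ and span an $|F_c|$-dimensional space.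
   Context: $E(v)\subseteq E_s$ is the set of tree edges on the path between $v$ and the root; $\mathrm{depth}(v)=|E(v)|$; for $e\in E_s$, $\mathrm{depth}(e)$ is the number of tree edges between $e$ and the root, edges adjacent to the root having depth $0$. $\mathbf n(e)\in\{0,1\}^{|E|}$ is the indicator vector of edge $e$, and $\mathbf c(e)$ denotes $\mathbf c(v,v')$ for $e=\{v,v'\}$ (for a self-loop $\{v\}$, $v'=v$).
   Formalization: The coefficient field is ℚ: membership in $\mathrm{Null}(\mathbf A)$ and the linear independence of the vectors $\mathbf c(e)$, $e\in F_c$, are taken over the rationals. -}

module Defs where

open import Data.Nat.Base using (ℕ; zero; suc; _⊓_; _%_; _≡ᵇ_) renaming (_+_ to _+ℕ_)
open import Data.Fin.Base using (Fin; zero; suc)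
open import Data.Fin.Properties using (_≟_)
open import Data.Bool.Base using (Bool; true; false; if_then_else_; _∧_; not; _∨_)
open import Data.Integer.Base using (+_)
open import Data.Rational.Base using (ℚ; 0ℚ; 1ℚ; -_; _+_; _*_; _/_)
open import Data.Product.Base using (_×_)
open import Data.Sum.Base using (_⊎_)
open import Relation.Nullary.Decidable.Core using (⌊_⌋)
open import Relation.Nullary.Negation.Core using (¬_)
open import Relation.Binary.PropositionalEquality using (_≡_)

Σℚ : ∀ {n} → (Fin n → ℚ) → ℚ
Σℚ {zero}  f = 0ℚ
Σℚ {suc n} f = f zero + Σℚ (λ i → f (suc i))

Σℕ : ∀ {n} → (Fin n → ℕ) → ℕ
Σℕ {zero}  f = 0
Σℕ {suc n} f = f zero +ℕ Σℕ (λ i → f (suc i))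

neg1^ : ℕ → ℚ
neg1^ zero    = 1ℚ
neg1^ (suc n) = - neg1^ n

isOdd : ℕ → Bool
isOdd n = (n % 2) ≡ᵇ 1

-- A graph on V = Fin m with edges indexed by Fin k; edge i is the set
-- {src i , tgt i}, a self-loop {v} when src i ≡ tgt i.
module Graph {m k : ℕ} (src tgt : Fin k → Fin m) where

  -- the edges are pairwise distinct as subsets of V (E is a set)
  SameEdge : Fin k → Fin k → Set
  SameEdge i j = (src i ≡ src j × tgt i ≡ tgt j) ⊎ (src i ≡ tgt j × tgt i ≡ src j)

  DistinctEdges : Set
  DistinctEdges = ∀ i j → SameEdge i j → i ≡ j

  data Reach (S : Fin k → Bool) : Fin m → Fin m → Set where
    here  : ∀ {u} → Reach S u u
    fwd   : ∀ {w} i → S i ≡ true → Reach S (tgt i) w → Reach S (src i) w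
    bwd   : ∀ {w} i → S i ≡ true → Reach S (src i) w → Reach S (tgt i) w

  allE : Fin k → Bool
  allE _ = true

  Connected : Set
  Connected = ∀ u v → Reach allE u v

  remove : (Fin k → Bool) → Fin k → (Fin k → Bool)
  remove S i j = S j ∧ not ⌊ j ≟ i ⌋

  -- Es is (the edge set of) a spanning tree: (V,Es) is connected and acyclic
  -- (every edge of Es is a bridge of (V,Es); this also excludes self-loops).
  IsSpanningTree : (Fin k → Bool) → Set
  IsSpanningTree Es =
    (∀ u v → Reach Es u v) ×
    (∀ i → Es i ≡ true → ¬ Reach (remove Es i) (src i) (tgt i))

  -- onPath v = E(v): the tree edges on the (unique) tree path from v to root,
  -- i.e. exactly those tree edges whose removal separates v from the root.
  IsPathEdges : (Fin k → Bool) → Fin m → (Fin m → Fin k → Bool) → Set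
  IsPathEdges Es root onPath = ∀ v j →
    (onPath v j ≡ true → (Es j ≡ true × ¬ Reach (remove Es j) v root)) ×
    ((Es j ≡ true × ¬ Reach (remove Es j) v root) → onPath v j ≡ true)

  module Tree (Es : Fin k → Bool) (onPath : Fin m → Fin k → Bool) where

    depth : Fin m → ℕ
    depth v = Σℕ (λ j → if onPath v j then 1 else 0)

    -- depth of a tree edge: number of tree edges between it and the root
    -- (= depth of its endpoint closer to the root)
    depthE : Fin k → ℕ
    depthE j = depth (src j) ⊓ depth (tgt j)

    nvec : Fin k → Fin k → ℚ
    nvec i j = if ⌊ j ≟ i ⌋ then 1ℚ else 0ℚ

    pathTerm : Fin m → Fin k → ℚ
    pathTerm v j = if onPath v j then neg1^ (depth v +ℕ depthE j) else 0ℚ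

    cvec : Fin k → Fin k → ℚ
    cvec i j = nvec i j + pathTerm (src i) j + pathTerm (tgt i) j

    inF : Fin k → Bool
    inF i = not (Es i)

    inFc : Fin k → Bool
    inFc i = inF i ∧ isOdd (depth (src i) +ℕ depth (tgt i))

  incid : Fin m → Fin k → ℚ
  incid v j =
    if ⌊ src j ≟ tgt j ⌋
      then (if ⌊ v ≟ src j ⌋ then (+ 2) / 1 else 0ℚ)
      else (if ⌊ v ≟ src j ⌋ ∨ ⌊ v ≟ tgt j ⌋ then (+ 2) / 2 else 0ℚ)

  InNull : (Fin k → ℚ) → Set
  InNull x = ∀ v → Σℚ (λ j → incid v j * x j) ≡ 0ℚ

-- Write P(v) for the path term Σ_{e ∈ E(v)} (-1)^{depth v + depth e} n(e) and s(v) = (-1)^{depth v}.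
-- If a tree edge e joins a child c to its parent p, then E(c) = E(p) ∪ {e} and depth e = depth p,
-- so P(c) + P(p) = -n(e) and s(c) + s(p) = 0.  Since A n({v,v'}) = δ_v + δ_v' (also for loops),
-- the quantity Φ(v) = δ_v + A P(v) therefore changes sign along every tree edge, and walking
-- from v to the root gives Φ(v) = s(v) δ_root.  Hence A c(v,v') = Φ(v) + Φ(v') = (s(v) + s(v')) δ_root,
-- which vanishes when depth v + depth v' is odd.  Independence is immediate: off the tree
-- every c(e) agrees with n(e), so the e-coordinate of a combination of the c(e), e ∈ F_c, is the
-- coefficient of c(e).
module Submission where

open import Defs
open import Algebra.Bundles using (CommutativeMonoid)
open import Data.Nat.Base using (ℕ; zero; suc; _⊓_) renaming (_+_ to _+ℕ_)
open import Data.Nat.Properties using (+-suc; m≥n⇒m⊓n≡n; m≤n⇒m⊓n≡m; n≤1+n)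
open import Data.Fin.Base using (Fin; zero; suc)
open import Data.Fin.Properties using (_≟_; suc-injective)
open import Data.Bool.Base using (Bool; true; false; if_then_else_; not)
open import Data.Bool.Properties using (⇔→≡)
open import Data.Rational.Base using (ℚ; 0ℚ; 1ℚ; -_; _+_; _*_)
open import Data.Rational.Properties
  using (+-comm; +-assoc; +-identityˡ; +-identityʳ; +-inverseˡ; +-inverseʳ; *-zeroʳ; *-identityʳ;
         *-distribˡ-+; neg-distrib-+; neg-distribʳ-*; +-0-group; +-0-commutativeMonoid)
open import Algebra.Properties.Group +-0-group using (⁻¹-involutive; inverseˡ-unique)
open import Algebra.Properties.CommutativeSemigroup
  (CommutativeMonoid.commutativeSemigroup +-0-commutativeMonoid) using (interchange)
open import Data.Product.Base using (_×_; _,_; proj₁; proj₂)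
open import Data.Sum.Base as Sum using (_⊎_; inj₁; inj₂)
open import Data.Empty using (⊥-elim)
open import Function.Base using (_∘_)
open import Function.Bundles using (mk⇔)
open import Relation.Nullary using (yes; no; ¬_)
open import Relation.Nullary.Decidable.Core using (⌊_⌋)
open import Relation.Binary.PropositionalEquality

Σℚ-cong : ∀ {n} {f g : Fin n → ℚ} → (∀ j → f j ≡ g j) → Σℚ f ≡ Σℚ g
Σℚ-cong {zero}  f≗g = refl
Σℚ-cong {suc n} f≗g = cong₂ _+_ (f≗g zero) (Σℚ-cong (λ j → f≗g (suc j)))

Σℚ-zero : ∀ {n} {f : Fin n → ℚ} → (∀ j → f j ≡ 0ℚ) → Σℚ f ≡ 0ℚ
Σℚ-zero {zero}  f≗0 = refl
Σℚ-zero {suc n} f≗0 = cong₂ _+_ (f≗0 zero) (Σℚ-zero (λ j → f≗0 (suc j)))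

Σℚ-+ : ∀ {n} (f g : Fin n → ℚ) → Σℚ (λ j → f j + g j) ≡ Σℚ f + Σℚ g
Σℚ-+ {zero}  f g = refl
Σℚ-+ {suc n} f g =
  trans (cong (f zero + g zero +_) (Σℚ-+ (λ j → f (suc j)) (λ j → g (suc j))))
        (interchange (f zero) (g zero) _ _)

Σℚ-neg : ∀ {n} (f : Fin n → ℚ) → Σℚ (λ j → - f j) ≡ - Σℚ f
Σℚ-neg {zero}  f = refl
Σℚ-neg {suc n} f =
  trans (cong (- f zero +_) (Σℚ-neg (λ j → f (suc j)))) (sym (neg-distrib-+ (f zero) _))

Σℚ-pick : ∀ {n} (f : Fin n → ℚ) i → (∀ j → j ≢ i → f j ≡ 0ℚ) → Σℚ f ≡ f i
Σℚ-pick f zero    others =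
  trans (cong (f zero +_) (Σℚ-zero (λ j → others (suc j) λ ()))) (+-identityʳ (f zero))
Σℚ-pick f (suc i) others =
  trans (cong₂ _+_ (others zero λ ())
                   (Σℚ-pick (λ j → f (suc j)) i
                            (λ j j≢i → others (suc j) (j≢i ∘ suc-injective))))
        (+-identityˡ (f (suc i)))

Σℕ-cong : ∀ {n} {f g : Fin n → ℕ} → (∀ j → f j ≡ g j) → Σℕ f ≡ Σℕ g
Σℕ-cong {zero}  f≗g = refl
Σℕ-cong {suc n} f≗g = cong₂ _+ℕ_ (f≗g zero) (Σℕ-cong (λ j → f≗g (suc j)))

Σℕ-zero : ∀ {n} {f : Fin n → ℕ} → (∀ j → f j ≡ 0) → Σℕ f ≡ 0
Σℕ-zero {zero}  f≗0 = refl
Σℕ-zero {suc n} f≗0 = cong₂ _+ℕ_ (f≗0 zero) (Σℕ-zero (λ j → f≗0 (suc j)))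

Σℕ-suc-at : ∀ {n} (f g : Fin n → ℕ) i → f i ≡ 1 → g i ≡ 0 →
  (∀ j → j ≢ i → f j ≡ g j) → Σℕ f ≡ suc (Σℕ g)
Σℕ-suc-at f g zero    fi≡1 gi≡0 others rewrite fi≡1 | gi≡0 =
  cong suc (Σℕ-cong (λ j → others (suc j) λ ()))
Σℕ-suc-at f g (suc i) fi≡1 gi≡0 others =
  trans (cong₂ _+ℕ_ (others zero λ ())
                    (Σℕ-suc-at (λ j → f (suc j)) (λ j → g (suc j)) i fi≡1 gi≡0
                               (λ j j≢i → others (suc j) (j≢i ∘ suc-injective))))
        (+-suc (g zero) _)

neg1^-double : ∀ n → neg1^ (n +ℕ n) ≡ 1ℚ
neg1^-double zero = refl
neg1^-double (suc n) rewrite +-suc n n = trans (⁻¹-involutive _) (neg1^-double n)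

neg1^-odd : ∀ n → isOdd n ≡ true → neg1^ n ≡ - 1ℚ
neg1^-odd (suc zero)    _   = refl
neg1^-odd (suc (suc n)) odd = trans (⁻¹-involutive _) (neg1^-odd n odd)

neg1^-odd-sum : ∀ a b → isOdd (a +ℕ b) ≡ true → neg1^ a + neg1^ b ≡ 0ℚ
neg1^-odd-sum zero    b odd = trans (cong (1ℚ +_) (neg1^-odd b odd)) (+-inverseʳ 1ℚ)
neg1^-odd-sum (suc a) b odd = begin
  - neg1^ a + neg1^ b         ≡⟨ cong (- neg1^ a +_) (sym (⁻¹-involutive (neg1^ b))) ⟩
  - neg1^ a + - - neg1^ b     ≡⟨ sym (neg-distrib-+ (neg1^ a) (- neg1^ b)) ⟩
  - (neg1^ a + neg1^ (suc b)) ≡⟨ cong -_ (neg1^-odd-sum a (suc b) odd′) ⟩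
  0ℚ                          ∎
  where
  open ≡-Reasoning
  odd′ : isOdd (a +ℕ suc b) ≡ true
  odd′ = subst (λ n → isOdd n ≡ true) (sym (+-suc a b)) odd

negated-scale : ∀ {x y a b} c → x + y ≡ 0ℚ → a + b ≡ 0ℚ → y ≡ c * b → x ≡ c * a
negated-scale {x} {y} {a} {b} c x+y≡0 a+b≡0 y≡cb = begin
  x         ≡⟨ inverseˡ-unique x y x+y≡0 ⟩
  - y       ≡⟨ cong -_ y≡cb ⟩
  - (c * b) ≡⟨ neg-distribʳ-* c b ⟩
  c * - b   ≡⟨ cong (c *_) (sym (inverseˡ-unique a b a+b≡0)) ⟩
  c * a     ∎
  where open ≡-Reasoning

module _ {m k : ℕ} (src tgt : Fin k → Fin m) where
  open Graph src tgt

  Reach-trans : ∀ {S x y z} → Reach S x y → Reach S y z → Reach S x z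
  Reach-trans here        r′ = r′
  Reach-trans (fwd i s r) r′ = fwd i s (Reach-trans r r′)
  Reach-trans (bwd i s r) r′ = bwd i s (Reach-trans r r′)

  Reach-sym : ∀ {S x y} → Reach S x y → Reach S y x
  Reach-sym here        = here
  Reach-sym (fwd i s r) = Reach-trans (Reach-sym r) (bwd i s here)
  Reach-sym (bwd i s r) = Reach-trans (Reach-sym r) (fwd i s here)

  remove-keeps : ∀ {S : Fin k → Bool} {i j} → S i ≡ true → i ≢ j → remove S j i ≡ true
  remove-keeps {i = i} {j} Si i≢j rewrite Si with i ≟ j
  ... | yes i≡j = ⊥-elim (i≢j i≡j)
  ... | no _    = refl

  Reach-remove⊎endpoint : ∀ {S x w} j → Reach S x w →
    Reach (remove S j) x w ⊎ (Reach (remove S j) x (src j) ⊎ Reach (remove S j) x (tgt j))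
  Reach-remove⊎endpoint j here = inj₁ here
  Reach-remove⊎endpoint {S} j (fwd i Si r) with i ≟ j
  ... | yes refl = inj₂ (inj₁ here)
  ... | no i≢j   = Sum.map step (Sum.map step step) (Reach-remove⊎endpoint j r)
    where
    step : ∀ {y} → Reach (remove S j) (tgt i) y → Reach (remove S j) (src i) y
    step = fwd i (remove-keeps {S} Si i≢j)
  Reach-remove⊎endpoint {S} j (bwd i Si r) with i ≟ j
  ... | yes refl = inj₂ (inj₂ here)
  ... | no i≢j   = Sum.map step (Sum.map step step) (Reach-remove⊎endpoint j r)
    where
    step : ∀ {y} → Reach (remove S j) (src i) y → Reach (remove S j) (tgt i) y
    step = bwd i (remove-keeps {S} Si i≢j)

  δ : Fin m → Fin m → ℚ
  δ u v = if ⌊ u ≟ v ⌋ then 1ℚ else 0ℚ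

  -- For a loop {v} the weight 2/|e| = 2 is exactly δ_v + δ_v.
  incid≡δ+δ : ∀ u i → incid u i ≡ δ u (src i) + δ u (tgt i)
  incid≡δ+δ u i with src i ≟ tgt i
  ... | yes s≡t rewrite s≡t with u ≟ tgt i
  ...   | yes _ = refl
  ...   | no _  = refl
  incid≡δ+δ u i | no s≢t with u ≟ src i | u ≟ tgt i
  ...   | yes u≡s | yes u≡t = ⊥-elim (s≢t (trans (sym u≡s) u≡t))
  ...   | yes _   | no _    = refl
  ...   | no _    | yes _   = refl
  ...   | no _    | no _    = refl

  Ax : (Fin k → ℚ) → Fin m → ℚ
  Ax x u = Σℚ (λ j → incid u j * x j)

  Ax-cong : ∀ {x y} u → (∀ j → x j ≡ y j) → Ax x u ≡ Ax y u
  Ax-cong u x≗y = Σℚ-cong (λ j → cong (incid u j *_) (x≗y j))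

  Ax-zero : ∀ {x} u → (∀ j → x j ≡ 0ℚ) → Ax x u ≡ 0ℚ
  Ax-zero u x≗0 = Σℚ-zero (λ j → trans (cong (incid u j *_) (x≗0 j)) (*-zeroʳ (incid u j)))

  Ax-+ : ∀ x y u → Ax (λ j → x j + y j) u ≡ Ax x u + Ax y u
  Ax-+ x y u = trans (Σℚ-cong (λ j → *-distribˡ-+ (incid u j) (x j) (y j)))
                     (Σℚ-+ (λ j → incid u j * x j) (λ j → incid u j * y j))

  Ax-neg : ∀ x u → Ax (λ j → - x j) u ≡ - Ax x u
  Ax-neg x u = trans (Σℚ-cong (λ j → sym (neg-distribʳ-* (incid u j) (x j))))
                     (Σℚ-neg (λ j → incid u j * x j))

  module _ (Es : Fin k → Bool) (root : Fin m) (tree : IsSpanningTree Es)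
           (onPath : Fin m → Fin k → Bool) (pathEdges : IsPathEdges Es root onPath) where
    open Tree Es onPath

    onPath⇒tree : ∀ {v j} → onPath v j ≡ true → Es j ≡ true
    onPath⇒tree {v} {j} on = proj₁ (proj₁ (pathEdges v j) on)

    onPath⇒separates : ∀ {v j} → onPath v j ≡ true → ¬ Reach (remove Es j) v root
    onPath⇒separates {v} {j} on = proj₂ (proj₁ (pathEdges v j) on)

    separates⇒onPath : ∀ {v j} → Es j ≡ true → ¬ Reach (remove Es j) v root → onPath v j ≡ true
    separates⇒onPath {v} {j} tj sep = proj₂ (pathEdges v j) (tj , sep)

    onPath-transport : ∀ {v w j} → Reach (remove Es j) w v → onPath v j ≡ true → onPath w j ≡ true
    onPath-transport w→v on =
      separates⇒onPath (onPath⇒tree on)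
                       (λ w→root → onPath⇒separates on (Reach-trans (Reach-sym w→v) w→root))

    onPath-offTree : ∀ v {j} → Es j ≡ false → onPath v j ≡ false
    onPath-offTree v {j} offTree with onPath v j in on
    ... | true  = trans (sym (onPath⇒tree on)) offTree
    ... | false = refl

    onPath-root : ∀ j → onPath root j ≡ false
    onPath-root j with onPath root j in on
    ... | true  = ⊥-elim (onPath⇒separates on here)
    ... | false = refl

    depth-root : depth root ≡ 0
    depth-root = Σℕ-zero (λ j → cong (λ b → if b then 1 else 0) (onPath-root j))

    onPath-endpoints : ∀ {i} j → Es i ≡ true → j ≢ i → onPath (src i) j ≡ onPath (tgt i) j
    onPath-endpoints {i} j ti j≢i =
      ⇔→≡ (mk⇔ (onPath-transport (Reach-sym edge)) (onPath-transport edge))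
      where
      edge : Reach (remove Es j) (src i) (tgt i)
      edge = fwd i (remove-keeps {Es} ti (λ i≡j → j≢i (sym i≡j))) here

    -- The tree path from the root to (src i) first meets i at an endpoint, so i does not cut both
    -- endpoints off the root; and it cuts off at least one of them because i is a bridge.
    onPath-one-endpoint : ∀ i → Es i ≡ true → onPath (src i) i ≡ not (onPath (tgt i) i)
    onPath-one-endpoint i ti with onPath (src i) i in onS | onPath (tgt i) i in onT
    ... | true  | false = refl
    ... | false | true  = refl
    ... | true  | true  with Reach-remove⊎endpoint i (proj₁ tree root (src i))
    ...   | inj₁ root→s        = ⊥-elim (onPath⇒separates onS (Reach-sym root→s))
    ...   | inj₂ (inj₁ root→s) = ⊥-elim (onPath⇒separates onS (Reach-sym root→s))
    ...   | inj₂ (inj₂ root→t) = ⊥-elim (onPath⇒separates onT (Reach-sym root→t))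
    onPath-one-endpoint i ti | false | false =
      ⊥-elim (notSeparated onS λ s→root → notSeparated onT λ t→root →
                proj₂ tree i ti (Reach-trans s→root (Reach-sym t→root)))
      where
      notSeparated : ∀ {v} → onPath v i ≡ false → ¬ ¬ Reach (remove Es i) v root
      notSeparated off sep with () ← trans (sym off) (separates⇒onPath ti sep)

    ChildParent : Fin k → Fin m → Fin m → Set
    ChildParent i c p =
      onPath c i ≡ true × onPath p i ≡ false × (∀ j → j ≢ i → onPath c j ≡ onPath p j)

    tree-edge-childParent : ∀ i → Es i ≡ true →
      ChildParent i (src i) (tgt i) ⊎ ChildParent i (tgt i) (src i)
    tree-edge-childParent i ti with onPath (src i) i | onPath (tgt i) i | onPath-one-endpoint i ti
    ... | true  | false | refl = inj₁ (refl , refl , λ j j≢i → onPath-endpoints j ti j≢i)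
    ... | false | true  | refl = inj₂ (refl , refl , λ j j≢i → sym (onPath-endpoints j ti j≢i))

    depth-child : ∀ {i c p} → ChildParent i c p → depth c ≡ suc (depth p)
    depth-child {i} (c-on , p-off , agree) =
      Σℕ-suc-at _ _ i (cong indicator c-on) (cong indicator p-off)
                (λ j j≢i → cong indicator (agree j j≢i))
      where
      indicator : Bool → ℕ
      indicator b = if b then 1 else 0

    Linked : Fin k → Fin m → Fin m → Set
    Linked i v w =
      (∀ j → pathTerm v j + pathTerm w j ≡ - nvec i j) × (neg1^ (depth v) + neg1^ (depth w) ≡ 0ℚ)

    child-linked : ∀ {i c p} → ChildParent i c p → depthE i ≡ depth p → Linked i c p
    child-linked {i} {c} {p} cp@(c-on , p-off , agree) depthE≡ = pathTerms , signs
      where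
      c-depth : depth c ≡ suc (depth p)
      c-depth = depth-child cp

      signs : neg1^ (depth c) + neg1^ (depth p) ≡ 0ℚ
      signs rewrite c-depth = +-inverseˡ (neg1^ (depth p))

      pathTerms : ∀ j → pathTerm c j + pathTerm p j ≡ - nvec i j
      pathTerms j with j ≟ i
      ... | yes refl rewrite c-on | p-off | c-depth | depthE≡ =
        trans (+-identityʳ _) (cong -_ (neg1^-double (depth p)))
      ... | no j≢i rewrite agree j j≢i with onPath p j
      ...   | true rewrite c-depth = +-inverseˡ (neg1^ (depth p +ℕ depthE j))
      ...   | false = refl

    Linked-sym : ∀ {i v w} → Linked i v w → Linked i w v
    Linked-sym {v = v} {w} (pathTerms , signs) =
      (λ j → trans (+-comm (pathTerm w j) (pathTerm v j)) (pathTerms j)) ,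
      trans (+-comm (neg1^ (depth w)) (neg1^ (depth v))) signs

    tree-edge-linked : ∀ i → Es i ≡ true → Linked i (src i) (tgt i)
    tree-edge-linked i ti with tree-edge-childParent i ti
    ... | inj₁ cp = child-linked cp
                      (trans (cong (_⊓ depth (tgt i)) (depth-child cp)) (m≥n⇒m⊓n≡n (n≤1+n _)))
    ... | inj₂ cp = Linked-sym (child-linked cp
                      (trans (cong (depth (src i) ⊓_) (depth-child cp)) (m≤n⇒m⊓n≡m (n≤1+n _))))

    Φ : Fin m → Fin m → ℚ
    Φ v u = δ u v + Ax (pathTerm v) u

    nvec-self : ∀ i → nvec i i ≡ 1ℚ
    nvec-self i with i ≟ i
    ... | yes _  = refl
    ... | no i≢i = ⊥-elim (i≢i refl)

    nvec-other : ∀ {i j} → j ≢ i → nvec i j ≡ 0ℚ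
    nvec-other {i} {j} j≢i with j ≟ i
    ... | yes j≡i = ⊥-elim (j≢i j≡i)
    ... | no _    = refl

    Ax-nvec : ∀ i u → Ax (nvec i) u ≡ δ u (src i) + δ u (tgt i)
    Ax-nvec i u = begin
      Ax (nvec i) u
        ≡⟨ Σℚ-pick (λ j → incid u j * nvec i j) i
                   (λ j j≢i → trans (cong (incid u j *_) (nvec-other j≢i)) (*-zeroʳ (incid u j))) ⟩
      incid u i * nvec i i      ≡⟨ cong (incid u i *_) (nvec-self i) ⟩
      incid u i * 1ℚ            ≡⟨ *-identityʳ (incid u i) ⟩
      incid u i                 ≡⟨ incid≡δ+δ u i ⟩
      δ u (src i) + δ u (tgt i) ∎
      where open ≡-Reasoning

    Φ-edge : ∀ i u → Linked i (src i) (tgt i) → Φ (src i) u + Φ (tgt i) u ≡ 0ℚ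
    Φ-edge i u (pathTerms , _) = begin
      Φ (src i) u + Φ (tgt i) u
        ≡⟨ interchange (δ u (src i)) (Ax (pathTerm (src i)) u)
                       (δ u (tgt i)) (Ax (pathTerm (tgt i)) u) ⟩
      (δ u (src i) + δ u (tgt i)) + (Ax (pathTerm (src i)) u + Ax (pathTerm (tgt i)) u)
        ≡⟨ cong₂ _+_ (sym (Ax-nvec i u)) (sym (Ax-+ (pathTerm (src i)) (pathTerm (tgt i)) u)) ⟩
      Ax (nvec i) u + Ax (λ j → pathTerm (src i) j + pathTerm (tgt i) j) u
        ≡⟨ cong (Ax (nvec i) u +_) (trans (Ax-cong u pathTerms) (Ax-neg (nvec i) u)) ⟩
      Ax (nvec i) u + - Ax (nvec i) u
        ≡⟨ +-inverseʳ (Ax (nvec i) u) ⟩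
      0ℚ ∎
      where open ≡-Reasoning

    Φ≡δroot : ∀ {v} → Reach Es v root → ∀ u → Φ v u ≡ δ u root * neg1^ (depth v)
    Φ≡δroot here u = begin
      δ u root + Ax (pathTerm root) u ≡⟨ cong (δ u root +_) (Ax-zero u pathTerm-root) ⟩
      δ u root + 0ℚ                  ≡⟨ +-identityʳ (δ u root) ⟩
      δ u root                       ≡⟨ sym (*-identityʳ (δ u root)) ⟩
      δ u root * 1ℚ                  ≡⟨ cong (λ d → δ u root * neg1^ d) (sym depth-root) ⟩
      δ u root * neg1^ (depth root)  ∎
      where
      open ≡-Reasoning
      pathTerm-root : ∀ j → pathTerm root j ≡ 0ℚ
      pathTerm-root j rewrite onPath-root j = refl
    Φ≡δroot (fwd i ti t→root) u =
      negated-scale (δ u root) (Φ-edge i u linked) (proj₂ linked) (Φ≡δroot t→root u)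
      where
      linked : Linked i (src i) (tgt i)
      linked = tree-edge-linked i ti
    Φ≡δroot (bwd i ti s→root) u =
      negated-scale (δ u root) (trans (+-comm (Φ (tgt i) u) (Φ (src i) u)) (Φ-edge i u linked))
                    (proj₂ (Linked-sym linked)) (Φ≡δroot s→root u)
      where
      linked : Linked i (src i) (tgt i)
      linked = tree-edge-linked i ti

    Ax-cvec : ∀ i u → Ax (cvec i) u ≡ δ u root * (neg1^ (depth (src i)) + neg1^ (depth (tgt i)))
    Ax-cvec i u = begin
      Ax (cvec i) u
        ≡⟨ trans (Ax-+ (λ j → nvec i j + pathTerm v j) (pathTerm v′) u)
                 (cong (_+ Ax (pathTerm v′) u) (Ax-+ (nvec i) (pathTerm v) u)) ⟩
      Ax (nvec i) u + Ax (pathTerm v) u + Ax (pathTerm v′) u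
        ≡⟨ cong (λ a → a + Ax (pathTerm v) u + Ax (pathTerm v′) u) (Ax-nvec i u) ⟩
      δ u v + δ u v′ + Ax (pathTerm v) u + Ax (pathTerm v′) u
        ≡⟨ +-assoc (δ u v + δ u v′) (Ax (pathTerm v) u) (Ax (pathTerm v′) u) ⟩
      (δ u v + δ u v′) + (Ax (pathTerm v) u + Ax (pathTerm v′) u)
        ≡⟨ interchange (δ u v) (δ u v′) (Ax (pathTerm v) u) (Ax (pathTerm v′) u) ⟩
      Φ v u + Φ v′ u
        ≡⟨ cong₂ _+_ (Φ≡δroot (proj₁ tree v root) u) (Φ≡δroot (proj₁ tree v′ root) u) ⟩
      δ u root * neg1^ (depth v) + δ u root * neg1^ (depth v′)
        ≡⟨ sym (*-distribˡ-+ (δ u root) (neg1^ (depth v)) (neg1^ (depth v′))) ⟩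
      δ u root * (neg1^ (depth v) + neg1^ (depth v′)) ∎
      where
      open ≡-Reasoning
      v v′ : Fin m
      v  = src i
      v′ = tgt i

    inFc⇒offTree : ∀ {i} → inFc i ≡ true → Es i ≡ false
    inFc⇒offTree {i} i∈Fc with Es i | i∈Fc
    ... | false | _ = refl

    inFc⇒odd : ∀ {i} → inFc i ≡ true → isOdd (depth (src i) +ℕ depth (tgt i)) ≡ true
    inFc⇒odd {i} i∈Fc with Es i | isOdd (depth (src i) +ℕ depth (tgt i)) | i∈Fc
    ... | false | true | _ = refl

    cvec-offTree : ∀ i {j} → Es j ≡ false → cvec i j ≡ nvec i j
    cvec-offTree i {j} offTree
      rewrite onPath-offTree (src i) offTree | onPath-offTree (tgt i) offTree =
      trans (+-identityʳ _) (+-identityʳ (nvec i j))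

    cvec-null : ∀ i → inFc i ≡ true → InNull (cvec i)
    cvec-null i i∈Fc u = begin
      Ax (cvec i) u
        ≡⟨ Ax-cvec i u ⟩
      δ u root * (neg1^ (depth v) + neg1^ (depth v′))
        ≡⟨ cong (δ u root *_) (neg1^-odd-sum (depth v) (depth v′) (inFc⇒odd i∈Fc)) ⟩
      δ u root * 0ℚ
        ≡⟨ *-zeroʳ (δ u root) ⟩
      0ℚ ∎
      where
      open ≡-Reasoning
      v v′ : Fin m
      v  = src i
      v′ = tgt i

    cvec-independent : ∀ (coef : Fin k → ℚ) →
      (∀ j → Σℚ (λ i → if inFc i then coef i * cvec i j else 0ℚ) ≡ 0ℚ) →
      ∀ i → inFc i ≡ true → coef i ≡ 0ℚ
    cvec-independent coef combination≡0 i i∈Fc = begin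
      coef i            ≡⟨ sym (*-identityʳ (coef i)) ⟩
      coef i * 1ℚ       ≡⟨ cong (coef i *_) (sym (trans (cvec-offTree i offTree) (nvec-self i))) ⟩
      coef i * cvec i i ≡⟨ cong (λ b → if b then coef i * cvec i i else 0ℚ) (sym i∈Fc) ⟩
      term i            ≡⟨ sym (Σℚ-pick term i others) ⟩
      Σℚ term           ≡⟨ combination≡0 i ⟩
      0ℚ                ∎
      where
      open ≡-Reasoning
      offTree : Es i ≡ false
      offTree = inFc⇒offTree i∈Fc
      term : Fin k → ℚ
      term i′ = if inFc i′ then coef i′ * cvec i′ i else 0ℚ
      others : ∀ i′ → i′ ≢ i → term i′ ≡ 0ℚ
      others i′ i′≢i with inFc i′
      ... | false = refl
      ... | true  = trans (cong (coef i′ *_)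
                                (trans (cvec-offTree i′ offTree) (nvec-other (i′≢i ∘ sym))))
                          (*-zeroʳ (coef i′))

lemma1 : ∀ {m k : ℕ} (src tgt : Fin k → Fin m) →
    Graph.DistinctEdges src tgt →
    Graph.Connected src tgt →
    (Es : Fin k → Bool) (root : Fin m) →
    Graph.IsSpanningTree src tgt Es →
    (onPath : Fin m → Fin k → Bool) →
    Graph.IsPathEdges src tgt Es root onPath →
    (∀ i → Graph.Tree.inFc src tgt Es onPath i ≡ true →
       Graph.InNull src tgt (Graph.Tree.cvec src tgt Es onPath i))
    ×
    (∀ (coef : Fin k → ℚ) →
       (∀ j → Σℚ (λ i → if Graph.Tree.inFc src tgt Es onPath i
                          then coef i * Graph.Tree.cvec src tgt Es onPath i j
                          else 0ℚ) ≡ 0ℚ) →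
       ∀ i → Graph.Tree.inFc src tgt Es onPath i ≡ true → coef i ≡ 0ℚ)
lemma1 src tgt _ _ Es root tree onPath pathEdges =
  cvec-null src tgt Es root tree onPath pathEdges ,
  cvec-independent src tgt Es root tree onPath pathEdges
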